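{- For every nonnegative integer $n$, there is a bijection between the set of partitions of $n$ with designated summands and the set of pairs $(\alpha,\beta)$ of partitions with $|\alpha|+|\beta|=n$, where $\alpha$ is an arbitrary ordinary partition and $\beta$ is a partition all of whose parts are $\not\equiv \pm1 \pmod 6$.
   Context: A partition of $n$ with designated summands is an ordinary partition of $n$ in which, for each part size that occurs, exactly one of the parts of that size is designated; if a size $t$ occurs $m_t$ times, the copies are regarded as ordered and the designation may be placed on any one of the $m_t$ positions, different positions giving different objects (e.g. $2'+2$ and $2+2'$ are distinct). $|\alpha|$ denotes the sum of parts of $\alpha$; the empty partition is allowed. -}

module Defs where

open import Data.Nat using (ℕ; zero; suc; _+_; _≥_; _≤_; _<_; _%_; _≟_)
open import Data.Fin using (Fin)
open import Data.List using (List; []; _∷_)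
open import Data.Nat.ListAction using (sum)
open import Data.Bool using (Bool; true; false; T)
open import Data.List.Relation.Unary.All using (All)
open import Data.List.Relation.Unary.Linked using (Linked)
open import Data.Product using (Σ; _×_)
open import Data.Unit using (⊤)
open import Relation.Nullary using (yes; no)
open import Relation.Binary.PropositionalEquality using (_≡_)

-- An (ordinary) partition of n: a weakly decreasing list of positive
-- integers summing to n.  (Proofs of ≥ and < on ℕ are unique, so
-- propositional equality of partitions is equality of the lists.)
IsPartition : ℕ → List ℕ → Set
IsPartition n l = Linked _≥_ l × All (λ k → 0 < k) l × sum l ≡ n

Partition : ℕ → Set
Partition n = Σ (List ℕ) (IsPartition n)

mult : ℕ → List ℕ → ℕ
mult t [] = 0
mult t (x ∷ l) with t ≟ x
... | yes _ = suc (mult t l)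
... | no  _ = mult t l

-- choices of a designated copy among m copies of a part size:
-- none needed if the size does not occur, otherwise one of m positions
Choice : ℕ → Set
Choice zero    = ⊤
Choice (suc m) = Fin (suc m)

Designation : List ℕ → ℕ → Set
Designation l zero    = ⊤
Designation l (suc k) = Choice (mult (suc k) l) × Designation l k

-- partitions of n with designated summands (all parts are ≤ n, so
-- sizes 1..n cover every part size that occurs)
PDS : ℕ → Set
PDS n = Σ (Partition n) (λ p → Designation (Σ.proj₁ p) n)

-- partitions of n none of whose parts is ≡ ±1 (mod 6)
-- (stated via a Boolean test so that proofs are unique, keeping the
-- bijection about the partitions themselves rather than about proofs)
notPM1 : ℕ → Bool
notPM1 1 = false
notPM1 5 = false
notPM1 _ = true

NoPM1mod6 : ℕ → Set
NoPM1mod6 k = T (notPM1 (k % 6))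

PartitionNo±1mod6 : ℕ → Set
PartitionNo±1mod6 n = Σ (List ℕ) (λ l → IsPartition n l × All NoPM1mod6 l)

Pairs : ℕ → Set
Pairs n = Σ ℕ (λ a → Σ ℕ (λ b → a + b ≡ n × Partition a × PartitionNo±1mod6 b))

-- A graded set A : ℕ → Set stands for its generating function Σ |A n| qⁿ, the
-- Cauchy product _⊗_ for multiplication, and scale s A for the substitution
-- q ↦ qˢ.  A partition whose parts of size k carry a structure counted by C k
-- then has generating function ∏ₖ C k (qᵏ).  For designated summands a size
-- occurring m > 0 times contributes m choices, so C k (q) = 1 + Σ m qᵐ =
-- (1 + q³)/((1 − q)(1 − q²)), and
--   PD(q) = ∏ 1/(1 − qᵏ) · ∏ 1/(1 − q²ᵏ) · ∏ (1 + q³ᵏ).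
-- By Euler's theorem ∏ (1 + q³ᵏ) = ∏ 1/(1 − q³⁽²ᵏ⁺¹⁾), and the last two
-- factors together run over the parts ≡ 0, 2, 3, 4 (mod 6).  Every step is an
-- explicit bijection of graded sets.  Products range over finitely many part
-- sizes, so identities between them are proved only up to a degree bound,
-- which is all the statement needs.

module Submission where

open import Defs
open import Level using (0ℓ) renaming (suc to lsuc)
open import Data.Nat using (ℕ; zero; suc; _+_; _*_; _∸_; _≤_; _<_; _≥_; z≤n; s≤s; z<s; _≟_; _%_; _/_; _≤?_; ⌊_/2⌋)
open import Data.Nat.Properties
open import Data.Nat.DivMod using (m≡m%n+[m/n]*n; m%n<n; [m+kn]%n≡m%n)
open import Data.Nat.Induction using (<-rec)
open import Data.Nat.ListAction using (sum)
open import Data.Nat.Tactic.RingSolver using (solve-∀)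
open import Data.Fin using (Fin; toℕ; fromℕ<)
open import Data.Fin.Properties using (toℕ≤pred[n]; toℕ-fromℕ<; fromℕ<-toℕ)
open import Data.Bool using (Bool; true; false; T; if_then_else_)
open import Data.Bool.Properties using (T-irrelevant)
open import Data.List using (List; []; _∷_; _++_; replicate)
open import Data.List.Properties using (∷-injectiveʳ)
open import Data.List.Relation.Unary.All as All using (All; []; _∷_)
open import Data.List.Relation.Unary.All.Properties using (++⁺; ++⁻ʳ; replicate⁺)
open import Data.List.Relation.Unary.Linked as Linked using (Linked; []; [-]; _∷_)
open import Data.List.Relation.Unary.Linked.Properties using (Linked⇒All)
open import Data.List.Relation.Unary.Any using (here; there)
open import Data.List.Membership.Propositional using (_∈_)
open import Data.Product using (Σ; _×_; _,_; proj₁)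
open import Data.Product.Function.NonDependent.Propositional using (_×-↔_)
open import Data.Product.Function.Dependent.Propositional using (Σ-↔)
open import Data.Unit using (⊤; tt)
open import Data.Empty using (⊥; ⊥-elim)
open import Relation.Nullary using (¬_; yes; no; contradiction)
open import Relation.Binary.Bundles using (Setoid)
import Relation.Binary.Reasoning.Setoid as SetoidReasoning
open import Relation.Binary.PropositionalEquality
open import Function.Bundles using (_↔_; mk↔ₛ′; Inverse; _⇔_; mk⇔; Equivalence)
open import Function.Properties.Inverse using (↔-refl; ↔-sym; ↔-trans)
open import Function.Related.Propositional using (module EquationalReasoning; ≡⇒)
open Inverse

-- Graded sets

Graded : Set₁
Graded = ℕ → Set

infix 4 _≃_ _≃[≤_]_
infixr 6 _⊗_

_≃_ : Graded → Graded → Set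
A ≃ B = ∀ n → A n ↔ B n

_≃[≤_]_ : Graded → ℕ → Graded → Set
A ≃[≤ L ] B = ∀ n → n ≤ L → A n ↔ B n

≃-refl : ∀ {A} → A ≃ A
≃-refl n = ↔-refl

≃-sym : ∀ {A B} → A ≃ B → B ≃ A
≃-sym f n = ↔-sym (f n)

≃-trans : ∀ {A B C} → A ≃ B → B ≃ C → A ≃ C
≃-trans f g n = ↔-trans (f n) (g n)

≃[≤]-refl : ∀ {A L} → A ≃[≤ L ] A
≃[≤]-refl n _ = ↔-refl

≃[≤]-sym : ∀ {A B L} → A ≃[≤ L ] B → B ≃[≤ L ] A
≃[≤]-sym f n n≤L = ↔-sym (f n n≤L)

≃[≤]-trans : ∀ {A B C L} → A ≃[≤ L ] B → B ≃[≤ L ] C → A ≃[≤ L ] C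
≃[≤]-trans f g n n≤L = ↔-trans (f n n≤L) (g n n≤L)

≃⇒≃[≤] : ∀ {A B L} → A ≃ B → A ≃[≤ L ] B
≃⇒≃[≤] f n _ = f n

≃[≤]-weaken : ∀ {A B L M} → M ≤ L → A ≃[≤ L ] B → A ≃[≤ M ] B
≃[≤]-weaken M≤L f n n≤M = f n (≤-trans n≤M M≤L)

≡⇒≃ : ∀ {A B : Graded} → A ≡ B → A ≃ B
≡⇒≃ refl = ≃-refl

≃-setoid : Setoid (lsuc 0ℓ) 0ℓ
≃-setoid = record
  { Carrier       = Graded
  ; _≈_           = _≃_
  ; isEquivalence = record { refl = ≃-refl ; sym = ≃-sym ; trans = ≃-trans }
  }

≃[≤]-setoid : ℕ → Setoid (lsuc 0ℓ) 0ℓ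
≃[≤]-setoid L = record
  { Carrier       = Graded
  ; _≈_           = λ A B → A ≃[≤ L ] B
  ; isEquivalence = record { refl = ≃[≤]-refl ; sym = ≃[≤]-sym ; trans = ≃[≤]-trans }
  }

module ≃-Reasoning = SetoidReasoning ≃-setoid
module ≃[≤]-Reasoning (L : ℕ) = SetoidReasoning (≃[≤]-setoid L)

𝟙 : Graded
𝟙 n = n ≡ 0

_⊗_ : Graded → Graded → Graded
(A ⊗ B) n = Σ ℕ λ i → Σ ℕ λ j → i + j ≡ n × A i × B j

scale : ℕ → Graded → Graded
scale s A n = Σ ℕ λ m → s * m ≡ n × A m

⊗-cong-at : ∀ {A A′ B B′} n → A ≃[≤ n ] A′ → B ≃[≤ n ] B′ → (A ⊗ B) n ↔ (A′ ⊗ B′) n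
⊗-cong-at {A} {A′} {B} {B′} n f g = mk↔ₛ′ to′ from′ to∘from from∘to
  where
  f′ : ∀ {i j} → i + j ≡ n → A i ↔ A′ i
  f′ {i} {j} refl = f i (m≤m+n i j)
  g′ : ∀ {i j} → i + j ≡ n → B j ↔ B′ j
  g′ {i} {j} refl = g j (m≤n+m j i)
  to′ : (A ⊗ B) n → (A′ ⊗ B′) n
  to′ (i , j , p , a , b) = i , j , p , to (f′ p) a , to (g′ p) b
  from′ : (A′ ⊗ B′) n → (A ⊗ B) n
  from′ (i , j , p , a , b) = i , j , p , from (f′ p) a , from (g′ p) b
  to∘from : ∀ y → to′ (from′ y) ≡ y
  to∘from (i , j , p , a , b) =
    cong₂ (λ x y → i , j , p , x , y) (strictlyInverseˡ (f′ p) a) (strictlyInverseˡ (g′ p) b)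
  from∘to : ∀ y → from′ (to′ y) ≡ y
  from∘to (i , j , p , a , b) =
    cong₂ (λ x y → i , j , p , x , y) (strictlyInverseʳ (f′ p) a) (strictlyInverseʳ (g′ p) b)

⊗-cong≤ : ∀ {A A′ B B′ L} → A ≃[≤ L ] A′ → B ≃[≤ L ] B′ → A ⊗ B ≃[≤ L ] A′ ⊗ B′
⊗-cong≤ f g n n≤L = ⊗-cong-at n (≃[≤]-weaken n≤L f) (≃[≤]-weaken n≤L g)

⊗-cong : ∀ {A A′ B B′} → A ≃ A′ → B ≃ B′ → A ⊗ B ≃ A′ ⊗ B′
⊗-cong f g n = ⊗-cong-at n (λ i _ → f i) (λ j _ → g j)

⊗-comm : ∀ {A B} → A ⊗ B ≃ B ⊗ A
⊗-comm {A} {B} n = mk↔ₛ′ swap swap swap² swap²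
  where
  swap : ∀ {A B} → (A ⊗ B) n → (B ⊗ A) n
  swap (i , j , p , a , b) = j , i , trans (+-comm j i) p , b , a
  swap² : ∀ {A B} (y : (A ⊗ B) n) → swap (swap y) ≡ y
  swap² (i , j , p , a , b) = cong (λ q → i , j , q , a , b) (≡-irrelevant _ _)

⊗-assoc : ∀ {A B C} → (A ⊗ B) ⊗ C ≃ A ⊗ (B ⊗ C)
⊗-assoc {A} {B} {C} n = mk↔ₛ′ to′ from′ to∘from from∘to
  where
  to′ : ((A ⊗ B) ⊗ C) n → (A ⊗ (B ⊗ C)) n
  to′ (._ , k , p , (i , j , refl , a , b) , c) = i , j + k , trans (sym (+-assoc i j k)) p , a , (j , k , refl , b , c)
  from′ : (A ⊗ (B ⊗ C)) n → ((A ⊗ B) ⊗ C) n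
  from′ (i , ._ , p , a , (j , k , refl , b , c)) = i + j , k , trans (+-assoc i j k) p , (i , j , refl , a , b) , c
  to∘from : ∀ y → to′ (from′ y) ≡ y
  to∘from (i , ._ , p , a , (j , k , refl , b , c)) =
    cong (λ q → i , j + k , q , a , (j , k , refl , b , c)) (≡-irrelevant _ _)
  from∘to : ∀ y → from′ (to′ y) ≡ y
  from∘to (._ , k , p , (i , j , refl , a , b) , c) =
    cong (λ q → i + j , k , q , (i , j , refl , a , b) , c) (≡-irrelevant _ _)

⊗-identityˡ : ∀ {A} → 𝟙 ⊗ A ≃ A
⊗-identityˡ {A} n = mk↔ₛ′ to′ from′ (λ _ → refl) from∘to
  where
  to′ : (𝟙 ⊗ A) n → A n
  to′ (.0 , j , refl , refl , a) = a
  from′ : A n → (𝟙 ⊗ A) n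
  from′ a = 0 , n , refl , refl , a
  from∘to : ∀ y → from′ (to′ y) ≡ y
  from∘to (.0 , j , refl , refl , a) = refl

⊗-identityʳ : ∀ {A} → A ⊗ 𝟙 ≃ A
⊗-identityʳ = ≃-trans ⊗-comm ⊗-identityˡ

⊗-interchange : ∀ {A B C D} → (A ⊗ B) ⊗ (C ⊗ D) ≃ (A ⊗ C) ⊗ (B ⊗ D)
⊗-interchange {A} {B} {C} {D} = begin
  (A ⊗ B) ⊗ (C ⊗ D)  ≈⟨ ⊗-assoc ⟩
  A ⊗ (B ⊗ (C ⊗ D))  ≈⟨ ⊗-cong ≃-refl ⊗-assoc ⟨
  A ⊗ ((B ⊗ C) ⊗ D)  ≈⟨ ⊗-cong ≃-refl (⊗-cong ⊗-comm ≃-refl) ⟩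
  A ⊗ ((C ⊗ B) ⊗ D)  ≈⟨ ⊗-cong ≃-refl ⊗-assoc ⟩
  A ⊗ (C ⊗ (B ⊗ D))  ≈⟨ ⊗-assoc ⟨
  (A ⊗ C) ⊗ (B ⊗ D)  ∎
  where open ≃-Reasoning

scale-cong-at : ∀ {A B} s n → (∀ m → s * m ≡ n → A m ↔ B m) → scale s A n ↔ scale s B n
scale-cong-at {A} {B} s n f = mk↔ₛ′ to′ from′ to∘from from∘to
  where
  to′ : scale s A n → scale s B n
  to′ (m , p , a) = m , p , to (f m p) a
  from′ : scale s B n → scale s A n
  from′ (m , p , a) = m , p , from (f m p) a
  to∘from : ∀ y → to′ (from′ y) ≡ y
  to∘from (m , p , a) = cong (λ x → m , p , x) (strictlyInverseˡ (f m p) a)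
  from∘to : ∀ y → from′ (to′ y) ≡ y
  from∘to (m , p , a) = cong (λ x → m , p , x) (strictlyInverseʳ (f m p) a)

scale-cong : ∀ {A B} s → A ≃ B → scale s A ≃ scale s B
scale-cong s f n = scale-cong-at s n (λ m _ → f m)

scale-cong≤ : ∀ {A B L M} s → A ≃[≤ L ] B → (∀ m → s * m ≤ M → m ≤ L) → scale s A ≃[≤ M ] scale s B
scale-cong≤ s f bound n n≤M = scale-cong-at s n (λ { m refl → f m (bound m n≤M) })

scale-≡ : ∀ {A s t} → s ≡ t → scale s A ≃ scale t A
scale-≡ refl = ≃-refl

scale-⊗ : ∀ {A B} s → scale s (A ⊗ B) ≃ scale s A ⊗ scale s B
scale-⊗ {A} {B} s n = mk↔ₛ′ to′ from′ to∘from from∘to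
  where
  to′ : scale s (A ⊗ B) n → (scale s A ⊗ scale s B) n
  to′ (._ , p , (i , j , refl , a , b)) =
    s * i , s * j , trans (sym (*-distribˡ-+ s i j)) p , (i , refl , a) , (j , refl , b)
  from′ : (scale s A ⊗ scale s B) n → scale s (A ⊗ B) n
  from′ (._ , ._ , p , (i , refl , a) , (j , refl , b)) = i + j , trans (*-distribˡ-+ s i j) p , (i , j , refl , a , b)
  to∘from : ∀ y → to′ (from′ y) ≡ y
  to∘from (._ , ._ , p , (i , refl , a) , (j , refl , b)) =
    cong (λ q → s * i , s * j , q , (i , refl , a) , (j , refl , b)) (≡-irrelevant _ _)
  from∘to : ∀ y → from′ (to′ y) ≡ y
  from∘to (._ , p , (i , j , refl , a , b)) = cong (λ q → i + j , q , (i , j , refl , a , b)) (≡-irrelevant _ _)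

scale-𝟙 : ∀ s → scale s 𝟙 ≃ 𝟙
scale-𝟙 s n = mk↔ₛ′ to′ from′ (λ _ → ≡-irrelevant _ _) from∘to
  where
  to′ : scale s 𝟙 n → 𝟙 n
  to′ (.0 , p , refl) = trans (sym p) (*-zeroʳ s)
  from′ : 𝟙 n → scale s 𝟙 n
  from′ n≡0 = 0 , trans (*-zeroʳ s) (sym n≡0) , refl
  from∘to : ∀ y → from′ (to′ y) ≡ y
  from∘to (.0 , p , refl) = cong (λ q → 0 , q , refl) (≡-irrelevant _ _)

scale-scale : ∀ {A} s t → scale s (scale t A) ≃ scale (s * t) A
scale-scale {A} s t n = mk↔ₛ′ to′ from′ to∘from from∘to
  where
  to′ : scale s (scale t A) n → scale (s * t) A n
  to′ (._ , p , (k , refl , a)) = k , trans (*-assoc s t k) p , a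
  from′ : scale (s * t) A n → scale s (scale t A) n
  from′ (k , p , a) = t * k , trans (sym (*-assoc s t k)) p , (k , refl , a)
  to∘from : ∀ y → to′ (from′ y) ≡ y
  to∘from (k , p , a) = cong (λ q → k , q , a) (≡-irrelevant _ _)
  from∘to : ∀ y → from′ (to′ y) ≡ y
  from∘to (._ , p , (k , refl , a)) = cong (λ q → t * k , q , (k , refl , a)) (≡-irrelevant _ _)

scale-comm : ∀ {A} s t → scale s (scale t A) ≃ scale t (scale s A)
scale-comm s t = ≃-trans (scale-scale s t) (≃-trans (scale-≡ (*-comm s t)) (≃-sym (scale-scale t s)))

scale-trivial : ∀ {A M} s → A 0 ↔ ⊤ → M < s → scale s A ≃[≤ M ] 𝟙
scale-trivial {A} {M} s A₀ M<s n n≤M = mk↔ₛ′ to′ from′ (λ _ → ≡-irrelevant _ _) from∘to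
  where
  positive-impossible : ∀ {m} → s * suc m ≢ n
  positive-impossible {m} p = <⇒≱ (≤-<-trans n≤M M<s) (subst (s ≤_) p (m≤m*n s (suc m)))
  to′ : scale s A n → 𝟙 n
  to′ (zero  , p , _) = trans (sym p) (*-zeroʳ s)
  to′ (suc m , p , _) = ⊥-elim (positive-impossible p)
  from′ : 𝟙 n → scale s A n
  from′ n≡0 = 0 , trans (*-zeroʳ s) (sym n≡0) , from A₀ tt
  from∘to : ∀ y → from′ (to′ y) ≡ y
  from∘to (zero  , p , a) = cong₂ (λ q x → 0 , q , x) (≡-irrelevant _ _) (strictlyInverseʳ A₀ a)
  from∘to (suc m , p , _) = ⊥-elim (positive-impossible p)

-- Finite products ∏ K F = F (K − 1) ⊗ ⋯ ⊗ F 0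

∏ : ℕ → (ℕ → Graded) → Graded
∏ zero    F = 𝟙
∏ (suc K) F = F K ⊗ ∏ K F

∏-cong : ∀ K {F G} → (∀ k → F k ≃ G k) → ∏ K F ≃ ∏ K G
∏-cong zero    f = ≃-refl
∏-cong (suc K) f = ⊗-cong (f K) (∏-cong K f)

∏-⊗ : ∀ K {F G} → ∏ K (λ k → F k ⊗ G k) ≃ ∏ K F ⊗ ∏ K G
∏-⊗ zero    = ≃-sym ⊗-identityˡ
∏-⊗ (suc K) = ≃-trans (⊗-cong ≃-refl (∏-⊗ K)) ⊗-interchange

scale-∏ : ∀ s K {F} → scale s (∏ K F) ≃ ∏ K (λ k → scale s (F k))
scale-∏ s zero    = scale-𝟙 s
scale-∏ s (suc K) = ≃-trans (scale-⊗ s) (⊗-cong ≃-refl (scale-∏ s K))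

∏-+ : ∀ c a {F} → ∏ (c + a) F ≃ ∏ c (λ r → F (a + r)) ⊗ ∏ a F
∏-+ zero    a     = ≃-sym ⊗-identityˡ
∏-+ (suc c) a {F} = ≃-trans (⊗-cong (≡⇒≃ (cong F (+-comm c a))) (∏-+ c a)) (≃-sym ⊗-assoc)

∏-* : ∀ J c {F} → ∏ (J * c) F ≃ ∏ J (λ j → ∏ c (λ r → F (j * c + r)))
∏-* zero    c = ≃-refl
∏-* (suc J) c = ≃-trans (∏-+ c (J * c)) (⊗-cong ≃-refl (∏-* J c))

∏-scale-truncate : ∀ {w : ℕ → ℕ} {A : ℕ → Graded} {M K} →
                   (∀ k → k < w k) → (∀ k → A k 0 ↔ ⊤) → M ≤ K →
                   ∏ K (λ k → scale (w k) (A k)) ≃[≤ M ] ∏ M (λ k → scale (w k) (A k))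
∏-scale-truncate {w} {A} {M} {K} k<w A₀ M≤K =
  subst (λ K → ∏ K F ≃[≤ M ] ∏ M F) (m∸n+n≡m M≤K) (extend (K ∸ M))
  where
  F : ℕ → Graded
  F k = scale (w k) (A k)
  extend : ∀ d → ∏ (d + M) F ≃[≤ M ] ∏ M F
  extend zero    = ≃[≤]-refl
  extend (suc d) = ≃[≤]-trans
    (⊗-cong≤ (scale-trivial (w (d + M)) (A₀ (d + M)) (≤-<-trans (m≤n+m M d) (k<w (d + M)))) (extend d))
    (≃⇒≃[≤] ⊗-identityˡ)

-- Euler's theorem

Unrestricted : Graded
Unrestricted _ = ⊤

AtMostOne : Graded
AtMostOne 0             = ⊤
AtMostOne 1             = ⊤
AtMostOne (suc (suc _)) = ⊥

AtMostOne-irrelevant : ∀ e (x y : AtMostOne e) → x ≡ y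
AtMostOne-irrelevant 0 tt tt = refl
AtMostOne-irrelevant 1 tt tt = refl

binary-digit : Unrestricted ≃ AtMostOne ⊗ scale 2 Unrestricted
binary-digit n = mk↔ₛ′ (λ _ → digit) (λ _ → tt) (unique digit) (λ _ → refl)
  where
  digit : (AtMostOne ⊗ scale 2 Unrestricted) n
  digit = n % 2 , 2 * (n / 2) , sym (trans (m≡m%n+[m/n]*n n 2) (cong (n % 2 +_) (*-comm (n / 2) 2))) ,
          remainder-bit (m%n<n n 2) , (n / 2 , refl , tt)
    where
    remainder-bit : ∀ {r} → r < 2 → AtMostOne r
    remainder-bit {0} _ = tt
    remainder-bit {1} _ = tt
    remainder-bit {suc (suc _)} (s≤s (s≤s ()))
  unique : ∀ (x y : (AtMostOne ⊗ scale 2 Unrestricted) n) → x ≡ y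
  unique (0 , ._ , p , tt , (h , refl , tt)) (0 , ._ , p′ , tt , (h′ , refl , tt))
    with *-cancelˡ-≡ h h′ 2 (trans p (sym p′))
  ... | refl = cong (λ q → 0 , 2 * h , q , tt , (h , refl , tt)) (≡-irrelevant _ _)
  unique (1 , ._ , p , tt , (h , refl , tt)) (1 , ._ , p′ , tt , (h′ , refl , tt))
    with *-cancelˡ-≡ h h′ 2 (suc-injective (trans p (sym p′)))
  ... | refl = cong (λ q → 1 , 2 * h , q , tt , (h , refl , tt)) (≡-irrelevant _ _)
  unique (0 , ._ , p , tt , (h , refl , tt)) (1 , ._ , p′ , tt , (h′ , refl , tt)) =
    ⊥-elim (even≢odd h h′ (trans p (sym p′)))
  unique (1 , ._ , p , tt , (h , refl , tt)) (0 , ._ , p′ , tt , (h′ , refl , tt)) =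
    ⊥-elim (even≢odd h′ h (trans p′ (sym p)))

DistinctParts OddParts OddDistinctParts : ℕ → Graded
DistinctParts    K = ∏ K (λ k → scale (suc k) AtMostOne)
OddParts         K = ∏ K (λ k → scale (suc (2 * k)) Unrestricted)
OddDistinctParts K = ∏ K (λ k → scale (suc (2 * k)) AtMostOne)

distinct-split : ∀ L → DistinctParts (L * 2) ≃ OddDistinctParts L ⊗ scale 2 (DistinctParts L)
distinct-split L = begin
  DistinctParts (L * 2)
    ≈⟨ ∏-* L 2 ⟩
  ∏ L (λ j → ∏ 2 (λ r → scale (suc (j * 2 + r)) AtMostOne))
    ≈⟨ ∏-cong L pair ⟩
  ∏ L (λ j → scale (suc (2 * j)) AtMostOne ⊗ scale 2 (scale (suc j) AtMostOne))
    ≈⟨ ∏-⊗ L ⟩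
  OddDistinctParts L ⊗ ∏ L (λ j → scale 2 (scale (suc j) AtMostOne))
    ≈⟨ ⊗-cong ≃-refl (scale-∏ 2 L) ⟨
  OddDistinctParts L ⊗ scale 2 (DistinctParts L) ∎
  where
  open ≃-Reasoning
  pair : ∀ j → ∏ 2 (λ r → scale (suc (j * 2 + r)) AtMostOne) ≃
               scale (suc (2 * j)) AtMostOne ⊗ scale 2 (scale (suc j) AtMostOne)
  pair j = ≃-trans (⊗-cong ≃-refl ⊗-identityʳ)
    (≃-trans ⊗-comm (⊗-cong (scale-≡ odd) (≃-sym (≃-trans (scale-scale 2 (suc j)) (scale-≡ even)))))
    where
    odd : suc (j * 2 + 0) ≡ suc (2 * j)
    odd = cong suc (trans (+-identityʳ _) (*-comm j 2))
    even : 2 * suc j ≡ suc (j * 2 + 1)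
    even = trans (*-comm 2 (suc j)) (cong suc (+-comm 1 (j * 2)))

odd-split : ∀ L → OddParts L ≃ OddDistinctParts L ⊗ scale 2 (OddParts L)
odd-split L = begin
  OddParts L
    ≈⟨ ∏-cong L (λ k → scale-cong (suc (2 * k)) binary-digit) ⟩
  ∏ L (λ k → scale (suc (2 * k)) (AtMostOne ⊗ scale 2 Unrestricted))
    ≈⟨ ∏-cong L (λ k → ≃-trans (scale-⊗ (suc (2 * k))) (⊗-cong ≃-refl (scale-comm (suc (2 * k)) 2))) ⟩
  ∏ L (λ k → scale (suc (2 * k)) AtMostOne ⊗ scale 2 (scale (suc (2 * k)) Unrestricted))
    ≈⟨ ∏-⊗ L ⟩
  OddDistinctParts L ⊗ ∏ L (λ k → scale 2 (scale (suc (2 * k)) Unrestricted))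
    ≈⟨ ⊗-cong ≃-refl (scale-∏ 2 L) ⟨
  OddDistinctParts L ⊗ scale 2 (OddParts L) ∎
  where open ≃-Reasoning

DistinctParts-truncate : ∀ {M K} → M ≤ K → DistinctParts K ≃[≤ M ] DistinctParts M
DistinctParts-truncate = ∏-scale-truncate (λ _ → ≤-refl) (λ _ → ↔-refl)

OddParts-truncate : ∀ {M K} → M ≤ K → OddParts K ≃[≤ M ] OddParts M
OddParts-truncate = ∏-scale-truncate (λ k → s≤s (m≤m+n k _)) (λ _ → ↔-refl)

2*m≤n⇒m≤⌊n/2⌋ : ∀ {m n} → 2 * m ≤ n → m ≤ ⌊ n /2⌋
2*m≤n⇒m≤⌊n/2⌋ {m} {n} 2m≤n = subst (_≤ ⌊ n /2⌋) (sym (n≡⌊n+n/2⌋ m))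
  (⌊n/2⌋-mono (subst (_≤ n) (cong (m +_) (+-identityʳ m)) 2m≤n))

-- DistinctParts and OddParts both satisfy X(q) = OddDistinctParts(q) · X(q²),
-- so agreement up to degree ⌊M/2⌋ yields agreement up to degree M.
euler : ∀ M L → M ≤ L → DistinctParts L ≃[≤ M ] OddParts L
euler = <-rec (λ M → ∀ L → M ≤ L → DistinctParts L ≃[≤ M ] OddParts L) step
  where
  step : ∀ M → (∀ {H} → H < M → ∀ L → H ≤ L → DistinctParts L ≃[≤ H ] OddParts L) →
         ∀ L → M ≤ L → DistinctParts L ≃[≤ M ] OddParts L
  step zero _ L _ = ≃[≤]-trans (DistinctParts-truncate {K = L} z≤n) (≃[≤]-sym (OddParts-truncate {K = L} z≤n))
  step M@(suc M′) rec L M≤L = begin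
    DistinctParts L
      ≈⟨ DistinctParts-truncate M≤L ⟩
    DistinctParts M
      ≈⟨ DistinctParts-truncate (≤-trans M≤L (m≤m*n L 2)) ⟨
    DistinctParts (L * 2)
      ≈⟨ ≃⇒≃[≤] (distinct-split L) ⟩
    OddDistinctParts L ⊗ scale 2 (DistinctParts L)
      ≈⟨ ⊗-cong≤ ≃[≤]-refl (scale-cong≤ 2 half (λ _ → 2*m≤n⇒m≤⌊n/2⌋)) ⟩
    OddDistinctParts L ⊗ scale 2 (OddParts L)
      ≈⟨ ≃⇒≃[≤] (odd-split L) ⟨
    OddParts L ∎
    where
    open ≃[≤]-Reasoning M
    half : DistinctParts L ≃[≤ ⌊ M /2⌋ ] OddParts L
    half = rec (⌊n/2⌋<n M′) L (≤-trans (⌊n/2⌋≤n M) M≤L)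

-- (1 + q³)/((1 − q)(1 − q²)) = 1 + Σ m qᵐ
ChoiceSeries : Graded
ChoiceSeries = Unrestricted ⊗ (scale 3 AtMostOne ⊗ scale 2 Unrestricted)

Key : Graded
Key m = Σ ℕ λ b → Σ ℕ λ e → AtMostOne e × 3 * e + 2 * b ≤ m

key-≡ : ∀ {m b e} (x y : AtMostOne e) (p q : 3 * e + 2 * b ≤ m) → _≡_ {A = Key m} (b , e , x , p) (b , e , y , q)
key-≡ {e = e} x y p q = cong₂ (λ x p → _ , e , x , p) (AtMostOne-irrelevant e x y) (≤-irrelevant p q)

choiceSeries↔key : ∀ m → ChoiceSeries m ↔ Key m
choiceSeries↔key m = mk↔ₛ′ to′ from′ to∘from from∘to
  where
  to′ : ChoiceSeries m → Key m
  to′ (a , ._ , a+w≡m , tt , (._ , ._ , refl , (e , refl , e≤1) , (b , refl , tt))) =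
    b , e , e≤1 , subst (_ ≤_) a+w≡m (m≤n+m _ a)
  from′ : Key m → ChoiceSeries m
  from′ (b , e , e≤1 , w≤m) = m ∸ (3 * e + 2 * b) , 3 * e + 2 * b , m∸n+n≡m w≤m , tt ,
                               (3 * e , 2 * b , refl , (e , refl , e≤1) , (b , refl , tt))
  to∘from : ∀ k → to′ (from′ k) ≡ k
  to∘from (b , e , e≤1 , w≤m) = key-≡ e≤1 e≤1 _ w≤m
  complement-unique : ∀ {w a a′} (p : a + w ≡ m) (p′ : a′ + w ≡ m) →
                      _≡_ {A = Σ ℕ λ a → a + w ≡ m} (a , p) (a′ , p′)
  complement-unique {w} {a} {a′} p p′ with +-cancelʳ-≡ w a a′ (trans p (sym p′))
  ... | refl = cong (a ,_) (≡-irrelevant p p′)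
  from∘to : ∀ y → from′ (to′ y) ≡ y
  from∘to (a , ._ , a+w≡m , tt , (._ , ._ , refl , (e , refl , e≤1) , (b , refl , tt))) =
    cong (λ { (a , p) → a , 3 * e + 2 * b , p , tt , (3 * e , 2 * b , refl , (e , refl , e≤1) , (b , refl , tt)) })
         (complement-unique _ a+w≡m)

key-zero : ⊤ ↔ Key 0
key-zero = mk↔ₛ′ (λ _ → 0 , 0 , tt , z≤n) (λ _ → tt) only (λ _ → refl)
  where
  only : ∀ k → (0 , 0 , tt , z≤n) ≡ k
  only (0 , 0 , tt , z≤n) = refl
  only (suc _ , 0 , _ , ())
  only (_ , 1 , _ , ())

Splits : ℕ → Set
Splits M = Σ ℕ λ i → Σ ℕ λ j → i + j ≡ M

splits-≡ : ∀ {M} (x y : Splits M) → proj₁ x ≡ proj₁ y → x ≡ y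
splits-≡ (i , j , p) (.i , j′ , p′) refl with +-cancelˡ-≡ i j j′ (trans p (sym p′))
... | refl = cong (λ q → i , j , q) (≡-irrelevant p p′)

fin↔splits : ∀ M → Fin (suc M) ↔ Splits M
fin↔splits M = mk↔ₛ′ to′ from′ (λ s → splits-≡ _ s (toℕ-fromℕ< _)) (λ i → fromℕ<-toℕ i _)
  where
  to′ : Fin (suc M) → Splits M
  to′ i = toℕ i , M ∸ toℕ i , m+[n∸m]≡n (toℕ≤pred[n] i)
  from′ : Splits M → Fin (suc M)
  from′ (i , j , p) = fromℕ< (s≤s (subst (i ≤_) p (m≤m+n i j)))

2*i≤1+i+j⇔i≤1+j : ∀ i j → 2 * i ≤ suc (i + j) ⇔ i ≤ suc j
2*i≤1+i+j⇔i≤1+j i j = mk⇔ (λ h → +-cancelˡ-≤ i _ _ (subst₂ _≤_ i+i i+1+j h))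
                          (λ h → subst₂ _≤_ (sym i+i) (sym i+1+j) (+-monoʳ-≤ i h))
  where
  i+i : 2 * i ≡ i + i
  i+i = cong (i +_) (+-identityʳ i)
  i+1+j : suc (i + j) ≡ i + suc j
  i+1+j = sym (+-suc i j)

3+2*j≤1+i+j⇔2+j≤i : ∀ i j → 3 + 2 * j ≤ suc (i + j) ⇔ 2 + j ≤ i
3+2*j≤1+i+j⇔2+j≤i i j = mk⇔ (λ h → +-cancelʳ-≤ (suc j) _ _ (subst₂ _≤_ (lhs j) (rhs i j) h))
                            (λ h → subst₂ _≤_ (sym (lhs j)) (sym (rhs i j)) (+-monoˡ-≤ (suc j) h))
  where
  lhs : ∀ j → 3 + 2 * j ≡ (2 + j) + suc j
  lhs = solve-∀
  rhs : ∀ i j → suc (i + j) ≡ i + suc j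
  rhs = solve-∀

-- Position i among M + 1 copies, with j = M − i copies after it, is keyed by
-- (i, 0) when i ≤ j + 1 and by (j, 1) otherwise.
splits↔key : ∀ M → Splits M ↔ Key (suc M)
splits↔key M = mk↔ₛ′ to′ from′ to∘from from∘to
  where
  to′ : Splits M → Key (suc M)
  to′ (i , j , i+j≡M) with i ≤? suc j
  ... | yes i≤1+j = i , 0 , tt ,
    subst (λ n → 2 * i ≤ suc n) i+j≡M (Equivalence.from (2*i≤1+i+j⇔i≤1+j i j) i≤1+j)
  ... | no  i≰1+j = j , 1 , tt ,
    subst (λ n → 3 + 2 * j ≤ suc n) i+j≡M (Equivalence.from (3+2*j≤1+i+j⇔2+j≤i i j) (≰⇒> i≰1+j))
  b≤M₀ : ∀ {b} → 2 * b ≤ suc M → b ≤ M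
  b≤M₀ h = ≤-pred (≤-<-trans (2*m≤n⇒m≤⌊n/2⌋ h) (⌊n/2⌋<n M))
  b≤M₁ : ∀ {b} → 3 + 2 * b ≤ suc M → b ≤ M
  b≤M₁ {b} h = ≤-trans (m≤m+n b (b + 0)) (≤-trans (m≤n+m (2 * b) 2) (≤-pred h))
  from′ : Key (suc M) → Splits M
  from′ (b , 0 , tt , h) = b , M ∸ b , m+[n∸m]≡n (b≤M₀ {b} h)
  from′ (b , 1 , tt , h) = M ∸ b , b , m∸n+n≡m (b≤M₁ {b} h)
  to∘from : ∀ k → to′ (from′ k) ≡ k
  to∘from (b , 0 , tt , h) with b ≤? suc (M ∸ b)
  ... | yes _  = key-≡ tt tt _ h
  ... | no b≰ = contradiction (Equivalence.to (2*i≤1+i+j⇔i≤1+j b (M ∸ b))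
                  (subst (λ n → 2 * b ≤ suc n) (sym (m+[n∸m]≡n (b≤M₀ {b} h))) h)) b≰
  to∘from (b , 1 , tt , h) with M ∸ b ≤? suc b
  ... | yes M∸b≤1+b = contradiction M∸b≤1+b (<⇒≱ (Equivalence.to (3+2*j≤1+i+j⇔2+j≤i (M ∸ b) b)
                  (subst (λ n → 3 + 2 * b ≤ suc n) (sym (m∸n+n≡m (b≤M₁ {b} h))) h)))
  ... | no _   = key-≡ tt tt _ h
  from∘to : ∀ s → from′ (to′ s) ≡ s
  from∘to (i , j , i+j≡M) with i ≤? suc j
  ... | yes _ = splits-≡ _ _ refl
  ... | no  _ = splits-≡ _ _ (trans (cong (_∸ j) (sym i+j≡M)) (m+n∸n≡m i j))

choice-decomposition : Choice ≃ ChoiceSeries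
choice-decomposition zero    = ↔-trans key-zero (↔-sym (choiceSeries↔key 0))
choice-decomposition (suc M) = ↔-trans (fin↔splits M) (↔-trans (splits↔key M) (↔-sym (choiceSeries↔key (suc M))))

-- Partitions with decorated part sizes as products

Bounded : ℕ → Graded
Bounded K n = Σ (List ℕ) λ l → IsPartition n l × All (_≤ K) l

bounded-≡ : ∀ {K n} (v w : Bounded K n) → proj₁ v ≡ proj₁ w → v ≡ w
bounded-≡ (l , (d , p , s) , b) (.l , (d′ , p′ , s′) , b′) refl =
  cong₂ (λ x y → l , x , y)
    (cong₂ _,_ (Linked.irrelevant ≤-irrelevant d d′)
               (cong₂ _,_ (All.irrelevant <-irrelevant p p′) (≡-irrelevant s s′)))
    (All.irrelevant ≤-irrelevant b b′)

parts≤sum : ∀ l → All (_≤ sum l) l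
parts≤sum []      = []
parts≤sum (x ∷ l) = m≤m+n x (sum l) ∷ All.map (λ h → ≤-trans h (m≤n+m (sum l) x)) (parts≤sum l)

partition-bounded : ∀ {K n l} → IsPartition n l → n ≤ K → All (_≤ K) l
partition-bounded {l = l} (_ , _ , refl) n≤K = All.map (λ h → ≤-trans h n≤K) (parts≤sum l)

partition↔bounded : ∀ {K n} → n ≤ K → Partition n ↔ Bounded K n
partition↔bounded n≤K = mk↔ₛ′ (λ { (l , p) → l , p , partition-bounded p n≤K }) (λ { (l , p , _) → l , p })
                              (λ v → bounded-≡ _ v refl) (λ _ → refl)

-- C k m is the set of decorations of the part size k when it occurs m times.
Decoration : (ℕ → Graded) → List ℕ → ℕ → Set
Decoration C l zero    = ⊤
Decoration C l (suc k) = C (suc k) (mult (suc k) l) × Decoration C l k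

Decorated : (ℕ → Graded) → ℕ → Graded
Decorated C K n = Σ (Bounded K n) λ v → Decoration C (proj₁ v) K

mult-∉ : ∀ {P : ℕ → Set} {t} l → All P l → ¬ P t → mult t l ≡ 0
mult-∉     []      _          _   = refl
mult-∉ {t = t} (x ∷ l) (px ∷ pl) ¬pt with t ≟ x
... | yes refl = contradiction px ¬pt
... | no  _    = mult-∉ l pl ¬pt

mult-∈ : ∀ {x l} → x ∈ l → 0 < mult x l
mult-∈ {x} {y ∷ l} (here refl) with x ≟ x
... | yes _  = s≤s z≤n
... | no x≢x = contradiction refl x≢x
mult-∈ {x} {y ∷ l} (there x∈l) with x ≟ y
... | yes _ = s≤s z≤n
... | no  _ = mult-∈ x∈l

mult-replicate-++ : ∀ t m r → mult t (replicate m t ++ r) ≡ m + mult t r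
mult-replicate-++ t zero    r = refl
mult-replicate-++ t (suc m) r with t ≟ t
... | yes _  = cong suc (mult-replicate-++ t m r)
... | no t≢t = contradiction refl t≢t

mult-replicate-++-≢ : ∀ {k t} m r → k ≢ t → mult k (replicate m t ++ r) ≡ mult k r
mult-replicate-++-≢         zero    r _   = refl
mult-replicate-++-≢ {k} {t} (suc m) r k≢t with k ≟ t
... | yes k≡t = contradiction k≡t k≢t
... | no  _   = mult-replicate-++-≢ m r k≢t

sum-replicate-++ : ∀ t m r → sum (replicate m t ++ r) ≡ t * m + sum r
sum-replicate-++ t zero    r = cong (_+ sum r) (sym (*-zeroʳ t))
sum-replicate-++ t (suc m) r = begin
  t + sum (replicate m t ++ r) ≡⟨ cong (t +_) (sum-replicate-++ t m r) ⟩
  t + (t * m + sum r)          ≡⟨ +-assoc t (t * m) (sum r) ⟨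
  t + t * m + sum r            ≡⟨ cong (_+ sum r) (*-suc t m) ⟨
  t * suc m + sum r            ∎
  where open ≡-Reasoning

replicate-++-injective : ∀ t m m′ r r′ → All (_< t) r → All (_< t) r′ →
                         replicate m t ++ r ≡ replicate m′ t ++ r′ → m ≡ m′ × r ≡ r′
replicate-++-injective t zero    zero     r r′ _ _ eq = refl , eq
replicate-++-injective t (suc m) (suc m′) r r′ a a′ eq
  with replicate-++-injective t m m′ r r′ a a′ (∷-injectiveʳ eq)
... | refl , r≡r′ = refl , r≡r′
replicate-++-injective t zero    (suc m′) (x ∷ r) r′ (x<t ∷ _) _ refl = ⊥-elim (<-irrefl refl x<t)
replicate-++-injective t (suc m) zero r (x ∷ r′) _ (x<t ∷ _) refl = ⊥-elim (<-irrefl refl x<t)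

linked-++⁻ʳ : ∀ xs {ys} → Linked _≥_ (xs ++ ys) → Linked _≥_ ys
linked-++⁻ʳ []       lk = lk
linked-++⁻ʳ (x ∷ xs) lk = linked-++⁻ʳ xs (Linked.tail lk)

linked-∷ : ∀ {t l} → All (_≤ t) l → Linked _≥_ l → Linked _≥_ (t ∷ l)
linked-∷ []          _  = [-]
linked-∷ (x≤t ∷ _)   lk = x≤t ∷ lk

replicate-++-bounded : ∀ {K} m r → All (_≤ K) r → All (_≤ suc K) (replicate m (suc K) ++ r)
replicate-++-bounded m r r≤K = ++⁺ (replicate⁺ m ≤-refl) (All.map m≤n⇒m≤1+n r≤K)

linked-replicate-++ : ∀ {K} m r → All (_≤ K) r → Linked _≥_ r → Linked _≥_ (replicate m (suc K) ++ r)
linked-replicate-++ zero    r r≤K lk = lk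
linked-replicate-++ (suc m) r r≤K lk = linked-∷ (replicate-++-bounded m r r≤K) (linked-replicate-++ m r r≤K lk)

split-largest : ∀ K l → All (_≤ suc K) l → Linked _≥_ l →
                Σ ℕ λ m → Σ (List ℕ) λ r → replicate m (suc K) ++ r ≡ l × All (_≤ K) r
split-largest K []       _          _  = 0 , [] , refl , []
split-largest K (x ∷ xs) (x≤1+K ∷ xs≤1+K) lk with suc K ≟ x
... | yes refl with split-largest K xs xs≤1+K (Linked.tail lk)
...   | m , r , eq , r≤K = suc m , r , cong (suc K ∷_) eq , r≤K
split-largest K (x ∷ xs) (x≤1+K ∷ _) lk | no 1+K≢x =
  0 , x ∷ xs , refl , Linked⇒All (λ j≤i k≤j → ≤-trans k≤j j≤i) x≤K lk
  where
  x≤K : x ≤ K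
  x≤K = ≤-pred (≤∧≢⇒< x≤1+K (λ x≡1+K → 1+K≢x (sym x≡1+K)))

Peeled : ℕ → Graded
Peeled K n = Σ ℕ λ m → Σ ℕ λ j → suc K * m + j ≡ n × Bounded K j

peeled-count : ∀ {K n} → Peeled K n → ℕ
peeled-count (m , _) = m

peeled-rest : ∀ {K n} → Peeled K n → List ℕ
peeled-rest (_ , _ , _ , (r , _)) = r

peeled-≡ : ∀ {K n} (x y : Peeled K n) → peeled-count x ≡ peeled-count y → peeled-rest x ≡ peeled-rest y → x ≡ y
peeled-≡ (m , ._ , e , v@(r , (_ , _ , refl) , _)) (.m , ._ , e′ , v′@(.r , (_ , _ , refl) , _)) refl refl =
  cong₂ (λ q v → m , sum r , q , v) (≡-irrelevant e e′) (bounded-≡ v v′ refl)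

peel : ∀ K n → Bounded (suc K) n → Peeled K n
peel K n (l , (lk , pos , sum≡n) , l≤1+K) with split-largest K l l≤1+K lk
... | m , r , eq , r≤K = m , sum r , trans (sym (sum-replicate-++ (suc K) m r)) (trans (cong sum eq) sum≡n) ,
  (r , (linked-++⁻ʳ (replicate m (suc K)) (subst (Linked _≥_) (sym eq) lk) ,
        ++⁻ʳ (replicate m (suc K)) (subst (All (0 <_)) (sym eq) pos) , refl) , r≤K)

unpeel : ∀ K n → Peeled K n → Bounded (suc K) n
unpeel K n (m , j , e , (r , (lk , pos , sum≡j) , r≤K)) =
  replicate m (suc K) ++ r ,
  (linked-replicate-++ m r r≤K lk , ++⁺ (replicate⁺ m z<s) pos ,
   trans (sum-replicate-++ (suc K) m r) (trans (cong (suc K * m +_) sum≡j) e)) ,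
  replicate-++-bounded m r r≤K

bounded↔peeled : ∀ K n → Bounded (suc K) n ↔ Peeled K n
bounded↔peeled K n = mk↔ₛ′ (peel K n) (unpeel K n) peel∘unpeel unpeel∘peel
  where
  peel∘unpeel : ∀ x → peel K n (unpeel K n x) ≡ x
  peel∘unpeel x@(m , j , e , (r , (lk , pos , s) , r≤K))
    with split-largest K (replicate m (suc K) ++ r) (replicate-++-bounded m r r≤K) (linked-replicate-++ m r r≤K lk)
  ... | m′ , r′ , eq , r′≤K
    with replicate-++-injective (suc K) m′ m r′ r (All.map s≤s r′≤K) (All.map s≤s r≤K) eq
  ...   | m′≡m , r′≡r = peeled-≡ _ x m′≡m r′≡r
  unpeel∘peel : ∀ v → unpeel K n (peel K n v) ≡ v
  unpeel∘peel v@(l , (lk , _ , _) , l≤1+K) with split-largest K l l≤1+K lk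
  ... | m , r , eq , r≤K = bounded-≡ _ v eq

decoration-cong : ∀ C {l r} K → (∀ k → k ≤ K → mult k l ≡ mult k r) → Decoration C l K ↔ Decoration C r K
decoration-cong C zero    same = ↔-refl
decoration-cong C (suc K) same =
  ≡⇒ (cong (C (suc K)) (same (suc K) ≤-refl)) ×-↔ decoration-cong C K (λ k k≤K → same k (m≤n⇒m≤1+n k≤K))

decoration-peel : ∀ C K n (v : Bounded (suc K) n) →
  Decoration C (proj₁ v) (suc K) ↔ (C (suc K) (peeled-count (peel K n v)) × Decoration C (peeled-rest (peel K n v)) K)
decoration-peel C K n (l , (lk , _ , _) , l≤1+K) with split-largest K l l≤1+K lk
... | m , r , refl , r≤K = ≡⇒ (cong (C (suc K)) count) ×-↔ decoration-cong C K below
  where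
  r<1+K : All (_< suc K) r
  r<1+K = All.map s≤s r≤K
  count : mult (suc K) (replicate m (suc K) ++ r) ≡ m
  count = begin
    mult (suc K) (replicate m (suc K) ++ r) ≡⟨ mult-replicate-++ (suc K) m r ⟩
    m + mult (suc K) r                      ≡⟨ cong (m +_) (mult-∉ r r<1+K (<-irrefl refl)) ⟩
    m + 0                                   ≡⟨ +-identityʳ m ⟩
    m                                       ∎
    where open ≡-Reasoning
  below : ∀ k → k ≤ K → mult k (replicate m (suc K) ++ r) ≡ mult k r
  below k k≤K = mult-replicate-++-≢ m r (λ k≡1+K → <-irrefl k≡1+K (s≤s k≤K))

decorated-zero : ∀ C → Decorated C 0 ≃ 𝟙
decorated-zero C n = mk↔ₛ′ to′ from′ (λ _ → ≡-irrelevant _ _) from∘to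
  where
  to′ : Decorated C 0 n → 𝟙 n
  to′ (([]    , (_ , _ , sum≡n) , _) , _) = sym sum≡n
  to′ ((_ ∷ _ , (_ , 0<x ∷ _ , _) , x≤0 ∷ _) , _) = ⊥-elim (<-irrefl refl (≤-trans 0<x x≤0))
  from′ : 𝟙 n → Decorated C 0 n
  from′ refl = ([] , ([] , [] , refl) , []) , tt
  from∘to : ∀ y → from′ (to′ y) ≡ y
  from∘to (v@([] , (_ , _ , refl) , _) , tt) = cong (_, tt) (bounded-≡ _ v refl)
  from∘to ((_ ∷ _ , (_ , 0<x ∷ _ , _) , x≤0 ∷ _) , _) = ⊥-elim (<-irrefl refl (≤-trans 0<x x≤0))

decorated↔∏ : ∀ C K → Decorated C K ≃ ∏ K (λ k → scale (suc k) (C (suc k)))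
decorated↔∏ C zero      = decorated-zero C
decorated↔∏ C (suc K) n = begin
  Decorated C (suc K) n
    ↔⟨ Σ-↔ (bounded↔peeled K n) (λ {v} → decoration-peel C K n v) ⟩
  (Σ (Peeled K n) λ x → C (suc K) (peeled-count x) × Decoration C (peeled-rest x) K)
    ↔⟨ regroup ⟩
  (scale (suc K) (C (suc K)) ⊗ Decorated C K) n
    ↔⟨ ⊗-cong-at n ≃[≤]-refl (λ j _ → decorated↔∏ C K j) ⟩
  ∏ (suc K) (λ k → scale (suc k) (C (suc k))) n ∎
  where
  open EquationalReasoning
  regroup : (Σ (Peeled K n) λ x → C (suc K) (peeled-count x) × Decoration C (peeled-rest x) K) ↔
            (scale (suc K) (C (suc K)) ⊗ Decorated C K) n
  regroup = mk↔ₛ′ (λ { ((m , j , e , v) , c , d) → suc K * m , j , e , (m , refl , c) , (v , d) })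
                  (λ { (._ , j , e , (m , refl , c) , (v , d)) → (m , j , e , v) , c , d })
                  (λ { (._ , j , e , (m , refl , c) , (v , d)) → refl })
                  (λ { ((m , j , e , v) , c , d) → refl })

Restricted : (ℕ → Bool) → ℕ → Graded
Restricted p k = if p k then Unrestricted else 𝟙

Restricted-irrelevant : ∀ p k m (x y : Restricted p k m) → x ≡ y
Restricted-irrelevant p k m x y with p k
... | true  = refl
... | false = ≡-irrelevant x y

Restricted-0 : ∀ p k → Restricted p k 0 ↔ ⊤
Restricted-0 p k with p k
... | true  = ↔-refl
... | false = mk↔ₛ′ (λ _ → tt) (λ _ → refl) (λ _ → refl) (λ _ → ≡-irrelevant _ _)

decoration-irrelevant : ∀ p l K (d d′ : Decoration (Restricted p) l K) → d ≡ d′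
decoration-irrelevant p l zero    tt       tt         = refl
decoration-irrelevant p l (suc K) (x , d) (x′ , d′) =
  cong₂ _,_ (Restricted-irrelevant p (suc K) _ x x′) (decoration-irrelevant p l K d d′)

decoration-lookup : ∀ C {l} K {x} → 0 < x → x ≤ K → Decoration C l K → C x (mult x l)
decoration-lookup C zero 0<x x≤0 _ = contradiction (≤-trans 0<x x≤0) λ ()
decoration-lookup C {l} (suc K) {x} 0<x x≤1+K (c , d) with x ≟ suc K
... | yes refl = c
... | no  x≢1+K = decoration-lookup C K 0<x (≤-pred (≤∧≢⇒< x≤1+K x≢1+K)) d

All⇒decoration : ∀ p {l} K → All (λ k → T (p k)) l → Decoration (Restricted p) l K
All⇒decoration p         zero    _      = tt
All⇒decoration p {l} (suc K) all-p = forbidden-absent , All⇒decoration p K all-p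
  where
  forbidden-absent : Restricted p (suc K) (mult (suc K) l)
  forbidden-absent with p (suc K) in eq
  ... | true  = tt
  ... | false = mult-∉ l all-p (λ t → subst T eq t)

decoration⇒All : ∀ p {l} K → All (0 <_) l → All (_≤ K) l →
                 Decoration (Restricted p) l K → All (λ k → T (p k)) l
decoration⇒All p {l} K pos l≤K d = All.tabulate allowed
  where
  allowed : ∀ {x} → x ∈ l → T (p x)
  allowed {x} x∈l with p x | decoration-lookup (Restricted p) K (All.lookup pos x∈l) (All.lookup l≤K x∈l) d
  ... | true  | _      = tt
  ... | false | absent = contradiction absent (>⇒≢ (mult-∈ x∈l))

restricted↔decorated : ∀ p {K b} → b ≤ K →
  (Σ (List ℕ) λ l → IsPartition b l × All (λ k → T (p k)) l) ↔ Decorated (Restricted p) K b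
restricted↔decorated p {K} b≤K = mk↔ₛ′ to′ from′ to∘from from∘to
  where
  to′ : (Σ (List ℕ) λ l → IsPartition _ l × All (λ k → T (p k)) l) → Decorated (Restricted p) K _
  to′ (l , ip , all-p) = (l , ip , partition-bounded ip b≤K) , All⇒decoration p K all-p
  from′ : Decorated (Restricted p) K _ → (Σ (List ℕ) λ l → IsPartition _ l × All (λ k → T (p k)) l)
  from′ ((l , ip@(_ , pos , _) , l≤K) , d) = l , ip , decoration⇒All p K pos l≤K d
  to∘from : ∀ y → to′ (from′ y) ≡ y
  to∘from ((l , ip , _) , d) =
    cong₂ (λ x y → (l , ip , x) , y) (All.irrelevant ≤-irrelevant _ _) (decoration-irrelevant p l K _ _)
  from∘to : ∀ y → from′ (to′ y) ≡ y
  from∘to (l , ip , _) = cong (λ x → l , ip , x) (All.irrelevant T-irrelevant _ _)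

notPM1mod6 : ℕ → Bool
notPM1mod6 k = notPM1 (k % 6)

Parts NoPM1Parts Evens : ℕ → Graded
Parts      K = ∏ K (λ k → scale (suc k) Unrestricted)
NoPM1Parts K = ∏ K (λ k → scale (suc k) (Restricted notPM1mod6 (suc k)))
Evens      K = ∏ K (λ k → scale (2 * suc k) Unrestricted)

NoPM1Parts-truncate : ∀ {M K} → M ≤ K → NoPM1Parts K ≃[≤ M ] NoPM1Parts M
NoPM1Parts-truncate = ∏-scale-truncate (λ _ → ≤-refl) (λ k → Restricted-0 notPM1mod6 (suc k))

Evens-truncate : ∀ {M K} → M ≤ K → Evens K ≃[≤ M ] Evens M
Evens-truncate = ∏-scale-truncate (λ k → s≤s (m≤m+n k _)) (λ _ → ↔-refl)

residue : ∀ j r → Restricted notPM1mod6 (suc (j * 6 + r)) ≡ Restricted notPM1mod6 (suc r)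
residue j r = cong (λ x → if notPM1 x then Unrestricted else 𝟙)
                   (trans (cong (λ x → suc x % 6) (+-comm (j * 6) r)) ([m+kn]%n≡m%n (suc r) j 6))

-- In the j-th block of six sizes the allowed ones are 6j + 2, 6j + 3, 6j + 4,
-- 6j + 6: the even sizes 2(3j + 1), 2(3j + 2), 2(3j + 3) and the odd
-- multiple 3(2j + 1) of three.
no±1-product : ∀ n → NoPM1Parts n ≃[≤ n ] scale 3 (OddParts n) ⊗ Evens n
no±1-product n = begin
  NoPM1Parts n
    ≈⟨ NoPM1Parts-truncate (m≤m*n n 6) ⟨
  NoPM1Parts (n * 6)
    ≈⟨ ≃⇒≃[≤] (∏-* n 6) ⟩
  ∏ n (λ j → ∏ 6 (λ r → scale (suc (j * 6 + r)) (Restricted notPM1mod6 (suc (j * 6 + r)))))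
    ≈⟨ ≃⇒≃[≤] (∏-cong n (λ j → ≃-trans (sixfold j) (≃-sym (threefold j)))) ⟩
  ∏ n (λ j → scale (3 * suc (2 * j)) Unrestricted ⊗ ∏ 3 (λ r → scale (2 * suc (j * 3 + r)) Unrestricted))
    ≈⟨ ≃⇒≃[≤] (∏-⊗ n) ⟩
  ∏ n (λ j → scale (3 * suc (2 * j)) Unrestricted) ⊗
  ∏ n (λ j → ∏ 3 (λ r → scale (2 * suc (j * 3 + r)) Unrestricted))
    ≈⟨ ≃⇒≃[≤] (⊗-cong odd (≃-sym (∏-* n 3))) ⟩
  scale 3 (OddParts n) ⊗ Evens (n * 3)
    ≈⟨ ⊗-cong≤ ≃[≤]-refl (Evens-truncate (m≤m*n n 3)) ⟩
  scale 3 (OddParts n) ⊗ Evens n ∎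
  where
  open ≃[≤]-Reasoning n
  B : ℕ → Graded
  B w = scale w Unrestricted
  Block : ℕ → Graded
  Block j = B (suc (j * 6 + 5)) ⊗ (B (suc (j * 6 + 3)) ⊗ (B (suc (j * 6 + 2)) ⊗ B (suc (j * 6 + 1))))
  sixfold : ∀ j → ∏ 6 (λ r → scale (suc (j * 6 + r)) (Restricted notPM1mod6 (suc (j * 6 + r)))) ≃ Block j
  sixfold j = ≃-trans
    (⊗-cong (f 5) (⊗-cong (≃-trans (f 4) (scale-𝟙 (suc (j * 6 + 4)))) (⊗-cong (f 3) (⊗-cong (f 2)
      (⊗-cong (f 1) (⊗-cong (≃-trans (f 0) (scale-𝟙 (suc (j * 6 + 0)))) ≃-refl))))))
    (⊗-cong ≃-refl (≃-trans ⊗-identityˡ (⊗-cong ≃-refl (⊗-cong ≃-refl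
      (≃-trans (⊗-cong ≃-refl ⊗-identityˡ) ⊗-identityʳ)))))
    where
    f : ∀ r → scale (suc (j * 6 + r)) (Restricted notPM1mod6 (suc (j * 6 + r))) ≃
              scale (suc (j * 6 + r)) (Restricted notPM1mod6 (suc r))
    f r = scale-cong (suc (j * 6 + r)) (≡⇒≃ (residue j r))
  threefold : ∀ j → B (3 * suc (2 * j)) ⊗ ∏ 3 (λ r → B (2 * suc (j * 3 + r))) ≃ Block j
  threefold j = ≃-trans
    (⊗-cong (scale-≡ (w3 j)) (⊗-cong (scale-≡ (w6 j)) (⊗-cong (scale-≡ (w4 j))
      (≃-trans (⊗-cong (scale-≡ (w2 j)) ≃-refl) ⊗-identityʳ))))
    (≃-trans ⊗-comm (≃-trans ⊗-assoc (⊗-cong ≃-refl (≃-trans ⊗-assoc (⊗-cong ≃-refl ⊗-comm)))))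
    where
    w3 : ∀ j → 3 * suc (2 * j) ≡ suc (j * 6 + 2)
    w3 = solve-∀
    w6 : ∀ j → 2 * suc (j * 3 + 2) ≡ suc (j * 6 + 5)
    w6 = solve-∀
    w4 : ∀ j → 2 * suc (j * 3 + 1) ≡ suc (j * 6 + 3)
    w4 = solve-∀
    w2 : ∀ j → 2 * suc (j * 3 + 0) ≡ suc (j * 6 + 1)
    w2 = solve-∀
  odd : ∏ n (λ j → B (3 * suc (2 * j))) ≃ scale 3 (OddParts n)
  odd = ≃-sym (≃-trans (scale-∏ 3 n) (∏-cong n (λ j → scale-scale 3 (suc (2 * j)))))

designated-product : ∀ n → ∏ n (λ k → scale (suc k) Choice) ≃ Parts n ⊗ (scale 3 (DistinctParts n) ⊗ Evens n)
designated-product n = begin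
  ∏ n (λ k → scale (suc k) Choice)
    ≈⟨ ∏-cong n (λ k → scale-cong (suc k) choice-decomposition) ⟩
  ∏ n (λ k → scale (suc k) ChoiceSeries)
    ≈⟨ ∏-cong n (λ k → ≃-trans (scale-⊗ (suc k)) (⊗-cong ≃-refl (≃-trans (scale-⊗ (suc k))
                         (⊗-cong (scale-comm (suc k) 3) (≃-trans (scale-comm (suc k) 2) (scale-scale 2 (suc k))))))) ⟩
  ∏ n (λ k → scale (suc k) Unrestricted ⊗ (scale 3 (scale (suc k) AtMostOne) ⊗ scale (2 * suc k) Unrestricted))
    ≈⟨ ≃-trans (∏-⊗ n) (⊗-cong ≃-refl (∏-⊗ n)) ⟩
  Parts n ⊗ (∏ n (λ k → scale 3 (scale (suc k) AtMostOne)) ⊗ Evens n)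
    ≈⟨ ⊗-cong ≃-refl (⊗-cong (scale-∏ 3 n) ≃-refl) ⟨
  Parts n ⊗ (scale 3 (DistinctParts n) ⊗ Evens n) ∎
  where open ≃-Reasoning

generating-identity : ∀ n → ∏ n (λ k → scale (suc k) Choice) ≃[≤ n ] Parts n ⊗ NoPM1Parts n
generating-identity n = begin
  ∏ n (λ k → scale (suc k) Choice)
    ≈⟨ ≃⇒≃[≤] (designated-product n) ⟩
  Parts n ⊗ (scale 3 (DistinctParts n) ⊗ Evens n)
    ≈⟨ ⊗-cong≤ ≃[≤]-refl (⊗-cong≤ (scale-cong≤ 3 (euler n n ≤-refl) (λ m → ≤-trans (m≤m+n m _)))
                                   ≃[≤]-refl) ⟩
  Parts n ⊗ (scale 3 (OddParts n) ⊗ Evens n)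
    ≈⟨ ⊗-cong≤ ≃[≤]-refl (no±1-product n) ⟨
  Parts n ⊗ NoPM1Parts n ∎
  where open ≃[≤]-Reasoning n

designation≡decoration : ∀ l k → Designation l k ≡ Decoration (λ _ → Choice) l k
designation≡decoration l zero    = refl
designation≡decoration l (suc k) = cong (Choice (mult (suc k) l) ×_) (designation≡decoration l k)

pds↔decorated : ∀ n → PDS n ↔ Decorated (λ _ → Choice) n n
pds↔decorated n = Σ-↔ (partition↔bounded ≤-refl) (λ {p} → ≡⇒ (designation≡decoration (proj₁ p) n))

partition↔Parts : ∀ {K a} → a ≤ K → Partition a ↔ Parts K a
partition↔Parts {K} {a} a≤K = begin
  Partition a
    ↔⟨ mk↔ₛ′ (λ { (l , ip) → l , ip , All.universal _ l }) (λ { (l , ip , _) → l , ip })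
             (λ { (l , ip , _) → cong (λ x → l , ip , x) (All.irrelevant (λ _ _ → refl) _ _) }) (λ _ → refl) ⟩
  (Σ (List ℕ) λ l → IsPartition a l × All (λ _ → ⊤) l)
    ↔⟨ restricted↔decorated (λ _ → true) a≤K ⟩
  Decorated (Restricted (λ _ → true)) K a
    ↔⟨ decorated↔∏ _ K a ⟩
  Parts K a ∎
  where open EquationalReasoning

noPM1↔NoPM1Parts : ∀ {K b} → b ≤ K → PartitionNo±1mod6 b ↔ NoPM1Parts K b
noPM1↔NoPM1Parts {K} {b} b≤K = ↔-trans (restricted↔decorated notPM1mod6 b≤K) (decorated↔∏ _ K b)

theorem3p1 : (n : ℕ) → PDS n ↔ Pairs n
theorem3p1 n = begin
  PDS n                                   ↔⟨ pds↔decorated n ⟩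
  Decorated (λ _ → Choice) n n            ↔⟨ decorated↔∏ (λ _ → Choice) n n ⟩
  ∏ n (λ k → scale (suc k) Choice) n      ↔⟨ generating-identity n n ≤-refl ⟩
  (Parts n ⊗ NoPM1Parts n) n              ↔⟨ ⊗-cong-at n (λ a a≤n → ↔-sym (partition↔Parts a≤n))
                                                         (λ b b≤n → ↔-sym (noPM1↔NoPM1Parts b≤n)) ⟩
  Pairs n                                 ∎
  where open EquationalReasoning
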